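{- Let $d\ge 2$, let $V=X\sqcup Y$ be a finite vertex set with a given bipartition, and let $\mathbf{p}_i\in\mathbb{R}^{d-1}$ ($i\in V$) be positions for the vertices. Then, restricted to subsets of the edge set $\{\{i,j\}: i\in X, j\in Y\}$ (bipartite graphs with that bipartition), the following two matroids coincide: (1) the $d$-dimensional bar-and-joint rigidity matroid of the points $(\mathbf{p}_i,0)$ for $i\in X$ and $(\mathbf{p}_j,1)$ for $j\in Y$; (2) the $d$-dimensional hyperconnectivity matroid of the points $(\mathbf{p}_i,1)$, $i\in V$.
   Context: For points $\mathbf{q}_v\in\mathbb{R}^d$ ($v\in V$), matrices have rows indexed by unordered pairs $\{i,j\}$ of vertices and $|V|d$ columns grouped into blocks of size $d$, one per vertex; row $\{i,j\}$ is zero outside blocks $i$ and $j$. Bar-and-joint rigidity matrix: $\mathbf{q}_i-\mathbf{q}_j$ in block $i$, $\mathbf{q}_j-\mathbf{q}_i$ in block $j$. Hyperconnectivity matrix: $\mathbf{q}_j$ in block $i$, $-\mathbf{q}_i$ in block $j$ (for a fixed ordering $i<j$; the sign convention does not affect the matroid). The corresponding matroid is the linear matroid of the rows, with ground set the pairs. -}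

module Defs where

open import Level using (Level; _⊔_)
open import Data.Nat as ℕ using (ℕ)
open import Data.Fin using (Fin; zero; suc; _≟_)
open import Data.Bool using (Bool; true; false; if_then_else_; T)
open import Data.Product using (Σ; _×_)
open import Relation.Nullary using (¬_; does)
open import Relation.Binary.PropositionalEquality using (_≡_)
open import Algebra.Bundles using (CommutativeRing)

record Field (c ℓ : Level) : Set (Level.suc (c ⊔ ℓ)) where
  field
    commutativeRing : CommutativeRing c ℓ
  open CommutativeRing commutativeRing public
  field
    1≉0     : ¬ (1# ≈ 0#)
    inverse : ∀ x → ¬ (x ≈ 0#) → Σ Carrier (λ y → x * y ≈ 1#)

module _ {c ℓ : Level} (𝔽 : Field c ℓ) where
  open Field 𝔽 using (Carrier; _≈_; _+_; _*_; -_; _-_; 0#; 1#)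

  sumFin : ∀ {n} → (Fin n → Carrier) → Carrier
  sumFin {ℕ.zero}  f = 0#
  sumFin {ℕ.suc n} f = f zero + sumFin (λ i → f (suc i))

  snoc : ∀ {m} → (Fin m → Carrier) → Carrier → Fin (ℕ.suc m) → Carrier
  snoc {ℕ.zero}  p t zero    = t
  snoc {ℕ.suc m} p t zero    = p zero
  snoc {ℕ.suc m} p t (suc k) = snoc (λ i → p (suc i)) t k

  -- Bar-and-joint rigidity matrix row of the edge {i,j}, entry in column
  -- (v , k): block v, coordinate k.
  barRow : ∀ {n D} → (Fin n → Fin D → Carrier) → Fin n → Fin n → Fin n → Fin D → Carrier
  barRow q i j v k =
    if does (v ≟ i) then q i k - q j k
    else if does (v ≟ j) then q j k - q i k
    else 0#

  hypRow : ∀ {n D} → (Fin n → Fin D → Carrier) → Fin n → Fin n → Fin n → Fin D → Carrier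
  hypRow q i j v k =
    if does (v ≟ i) then q j k
    else if does (v ≟ j) then - (q i k)
    else 0#

  RowsIndependent : ∀ {n D} → (Fin n → Fin n → Fin n → Fin D → Carrier)
                  → (Fin n → Fin n → Bool) → Set (c ⊔ ℓ)
  RowsIndependent row S =
    (λc : Fin _ → Fin _ → Carrier) →
    (∀ v k → sumFin (λ i → sumFin (λ j →
               if S i j then λc i j * row i j v k else 0#)) ≈ 0#) →
    ∀ i j → T (S i j) → λc i j ≈ 0#

-- S is a set of edges of the complete bipartite graph between
-- X = {v | side v ≡ false} and Y = {v | side v ≡ true}; the edge {x,y}
-- (x ∈ X, y ∈ Y) is encoded by the ordered pair (x , y).
BipartiteEdgeSet : ∀ {n} → (Fin n → Bool) → (Fin n → Fin n → Bool) → Set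
BipartiteEdgeSet side S = ∀ i j → T (S i j) → (side i ≡ false) × (side j ≡ true)

{-# OPTIONS --safe #-}
module Submission where

open import Defs
open import Level using (Level)
open import Data.Nat using (ℕ; suc; _≤_)
open import Data.Fin using (Fin; zero; suc; fromℕ; _≟_)
open import Data.Bool using (Bool; true; false; if_then_else_; T)
open import Data.Unit using (tt)
open import Data.Product using (_×_; _,_)
open import Data.Maybe using (nothing)
open import Relation.Nullary using (yes; no)
open import Relation.Binary.PropositionalEquality as ≡ using (_≡_)
open import Function.Bundles using (_⇔_; mk⇔)
open import Tactic.RingSolver.Core.AlmostCommutativeRing using (fromCommutativeRing)
import Algebra.Definitions
import Relation.Binary.Reasoning.Setoid as SetoidReasoning
import Tactic.RingSolver.NonReflective as RingSolver

-- On an edge {i,j} with i ∈ X and j ∈ Y the last coordinate of the hyperconnectivity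
-- row is 1 in block i and -1 in block j.  Hence in every block v the bar-and-joint
-- row is the image of the hyperconnectivity row under one fixed linear map of F^(m+1),
-- the shear  h ↦ α_v ⋅ h_last + β_v ⋅ h  with
--   α_x = (p_x, 0),   β_x = -1   for x ∈ X,
--   α_y = -(p_y, 2),  β_y = 1    for y ∈ Y.
-- It sends h_last to (α_v,last + β_v) h_last = -h_last, so it is invertible, and a
-- linear combination of rows vanishes in one matrix iff it vanishes in the other.

module _ {c ℓ′ : Level} (𝔽 : Field c ℓ′) where
  open Field 𝔽 hiding (zero)
  open import Algebra.Properties.Ring ring using (-1*x≈-x)
  open import Algebra.Properties.AbelianGroup +-abelianGroup
    using (ε⁻¹≈ε; ⁻¹-involutive; ⁻¹-anti-homo‿-; xyx⁻¹≈y)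
  open Algebra.Definitions _≈_ using (LeftInvertible)
  open SetoidReasoning setoid
  open RingSolver (fromCommutativeRing commutativeRing (λ _ → nothing))
    using (solve; _⊜_; _⊕_; _⊗_)

  linear-zero : ∀ a b → a * 0# + b * 0# ≈ 0#
  linear-zero a b = trans (+-cong (zeroʳ a) (zeroʳ b)) (+-identityˡ 0#)

  sumFin-cong : ∀ {n} {f g : Fin n → Carrier} → (∀ i → f i ≈ g i) → sumFin 𝔽 f ≈ sumFin 𝔽 g
  sumFin-cong {ℕ.zero}  f≈g = refl
  sumFin-cong {ℕ.suc n} f≈g = +-cong (f≈g zero) (sumFin-cong (λ i → f≈g (suc i)))

  sumFin-linear : ∀ {n} a b (f g : Fin n → Carrier) →
    sumFin 𝔽 (λ i → a * f i + b * g i) ≈ a * sumFin 𝔽 f + b * sumFin 𝔽 g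
  sumFin-linear {ℕ.zero}  a b f g = sym (linear-zero a b)
  sumFin-linear {ℕ.suc n} a b f g = begin
    (a * f zero + b * g zero) + sumFin 𝔽 (λ i → a * f (suc i) + b * g (suc i))
      ≈⟨ +-cong refl (sumFin-linear a b (λ i → f (suc i)) (λ i → g (suc i))) ⟩
    (a * f zero + b * g zero) + (a * F + b * G)
      ≈⟨ solve 6 (λ a b x y u w → ((a ⊗ x ⊕ b ⊗ y) ⊕ (a ⊗ u ⊕ b ⊗ w))
                                    ⊜ (a ⊗ (x ⊕ u) ⊕ b ⊗ (y ⊕ w)))
               refl a b (f zero) (g zero) F G ⟩
    a * (f zero + F) + b * (g zero + G) ∎
    where
    F G : Carrier
    F = sumFin 𝔽 (λ i → f (suc i))
    G = sumFin 𝔽 (λ i → g (suc i))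

  Rows : ℕ → ℕ → Set c
  Rows n D = Fin n → Fin n → Fin n → Fin D → Carrier

  combination : ∀ {n D} → Rows n D → (Fin n → Fin n → Bool) →
                (Fin n → Fin n → Carrier) → Fin n → Fin D → Carrier
  combination row S λc v k =
    sumFin 𝔽 (λ i → sumFin 𝔽 (λ j → if S i j then λc i j * row i j v k else 0#))

  shear : ∀ {D} → (Fin D → Carrier) → Carrier → Fin D → (Fin D → Carrier) → Fin D → Carrier
  shear α β ℓ x k = α k * x ℓ + β * x k

  shear-zero : ∀ {D} α β ℓ {x : Fin D → Carrier} → (∀ k → x k ≈ 0#) → ∀ k → shear α β ℓ x k ≈ 0#
  shear-zero α β ℓ x≈0 k =
    trans (+-cong (*-cong refl (x≈0 ℓ)) (*-cong refl (x≈0 k))) (linear-zero (α k) β)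

  leftInvertible-cancel : ∀ {u x} → LeftInvertible 1# _*_ u → u * x ≈ 0# → x ≈ 0#
  leftInvertible-cancel {u} {x} (u⁻¹ , u⁻¹u≈1) ux≈0 = begin
    x              ≈⟨ sym (*-identityˡ x) ⟩
    1# * x         ≈⟨ *-cong (sym u⁻¹u≈1) refl ⟩
    (u⁻¹ * u) * x  ≈⟨ *-assoc u⁻¹ u x ⟩
    u⁻¹ * (u * x)  ≈⟨ *-cong refl ux≈0 ⟩
    u⁻¹ * 0#       ≈⟨ zeroʳ u⁻¹ ⟩
    0#             ∎

  shear-injective : ∀ {D} α β ℓ {x : Fin D → Carrier} →
    LeftInvertible 1# _*_ β → LeftInvertible 1# _*_ (α ℓ + β) →
    (∀ k → shear α β ℓ x k ≈ 0#) → ∀ k → x k ≈ 0#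
  shear-injective α β ℓ {x} β-inv αℓ+β-inv shear≈0 k =
    leftInvertible-cancel β-inv (begin
      β * x k                ≈⟨ sym (+-identityˡ (β * x k)) ⟩
      0# + β * x k           ≈⟨ +-cong (sym (trans (*-cong refl xℓ≈0) (zeroʳ (α k)))) refl ⟩
      α k * x ℓ + β * x k    ≈⟨ shear≈0 k ⟩
      0#                     ∎)
    where
    xℓ≈0 : x ℓ ≈ 0#
    xℓ≈0 = leftInvertible-cancel αℓ+β-inv (trans (distribʳ (x ℓ) (α ℓ) β) (shear≈0 ℓ))

  combination-shear : ∀ {n D} {row₁ row₂ : Rows n D} (S : Fin n → Fin n → Bool)
    (α : Fin n → Fin D → Carrier) (β : Fin n → Carrier) (ℓ : Fin D) →
    (∀ i j → T (S i j) → ∀ v k → row₁ i j v k ≈ shear (α v) (β v) ℓ (row₂ i j v) k) →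
    ∀ λc v k → combination row₁ S λc v k ≈ shear (α v) (β v) ℓ (combination row₂ S λc v) k
  combination-shear {n} {D} {row₁} {row₂} S α β ℓ row₁≈shear λc v k =
    trans (sumFin-cong (λ i → trans (sumFin-cong (summand-shear i))
                                    (sumFin-linear a b (term ℓ i) (term k i))))
          (sumFin-linear a b (λ i → sumFin 𝔽 (term ℓ i)) (λ i → sumFin 𝔽 (term k i)))
    where
    a : Carrier
    a = α v k
    b : Carrier
    b = β v
    term : Fin D → Fin n → Fin n → Carrier
    term k′ i j = if S i j then λc i j * row₂ i j v k′ else 0#
    summand-shear : ∀ i j → (if S i j then λc i j * row₁ i j v k else 0#) ≈ a * term ℓ i j + b * term k i j
    summand-shear i j with S i j | row₁≈shear i j
    ... | true  | row₁≈ = trans (*-cong refl (row₁≈ tt v k))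
      (solve 5 (λ l a x b y → (l ⊗ (a ⊗ x ⊕ b ⊗ y)) ⊜ (a ⊗ (l ⊗ x) ⊕ b ⊗ (l ⊗ y)))
             refl (λc i j) a (row₂ i j v ℓ) b (row₂ i j v k))
    ... | false | _     = sym (linear-zero a b)

  rowsIndependent-shear : ∀ {n D} {row₁ row₂ : Rows n D} (S : Fin n → Fin n → Bool)
    (α : Fin n → Fin D → Carrier) (β : Fin n → Carrier) (ℓ : Fin D) →
    (∀ i j → T (S i j) → ∀ v k → row₁ i j v k ≈ shear (α v) (β v) ℓ (row₂ i j v) k) →
    (∀ v → LeftInvertible 1# _*_ (β v)) → (∀ v → LeftInvertible 1# _*_ (α v ℓ + β v)) →
    RowsIndependent 𝔽 row₁ S ⇔ RowsIndependent 𝔽 row₂ S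
  rowsIndependent-shear {row₁ = row₁} {row₂} S α β ℓ row₁≈shear β-inv αℓ+β-inv = mk⇔
    (λ indep₁ λc comb₂≈0 → indep₁ λc λ v k →
      trans (comb₁≈shear λc v k) (shear-zero (α v) (β v) ℓ (comb₂≈0 v) k))
    (λ indep₂ λc comb₁≈0 → indep₂ λc λ v →
      shear-injective (α v) (β v) ℓ (β-inv v) (αℓ+β-inv v)
        (λ k → trans (sym (comb₁≈shear λc v k)) (comb₁≈0 v k)))
    where
    comb₁≈shear : ∀ λc v k → combination row₁ S λc v k ≈ shear (α v) (β v) ℓ (combination row₂ S λc v) k
    comb₁≈shear = combination-shear S α β ℓ row₁≈shear

  leftInvertible-resp : ∀ {x y} → x ≈ y → LeftInvertible 1# _*_ y → LeftInvertible 1# _*_ x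
  leftInvertible-resp x≈y (y⁻¹ , y⁻¹y≈1) = y⁻¹ , trans (*-cong refl x≈y) y⁻¹y≈1

  -1-leftInvertible : LeftInvertible 1# _*_ (- 1#)
  -1-leftInvertible = - 1# , trans (-1*x≈-x (- 1#)) (⁻¹-involutive 1#)

  snoc-last : ∀ {m} (q : Fin m → Carrier) t → snoc 𝔽 q t (fromℕ m) ≡ t
  snoc-last {ℕ.zero}  q t = ≡.refl
  snoc-last {ℕ.suc m} q t = snoc-last (λ i → q (suc i)) t

  snoc-differenceCong : ∀ {m} (q q′ : Fin m → Carrier) {s t s′ t′} → s - t ≈ s′ - t′ → ∀ k →
    snoc 𝔽 q s k - snoc 𝔽 q′ t k ≈ snoc 𝔽 q s′ k - snoc 𝔽 q′ t′ k
  snoc-differenceCong {ℕ.zero}  q q′ eq zero    = eq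
  snoc-differenceCong {ℕ.suc m} q q′ eq zero    = refl
  snoc-differenceCong {ℕ.suc m} q q′ eq (suc k) =
    snoc-differenceCong (λ i → q (suc i)) (λ i → q′ (suc i)) eq k

  shearColumn : ∀ {m} → Bool → (Fin m → Carrier) → Fin (suc m) → Carrier
  shearColumn false q k = snoc 𝔽 q 0# k
  shearColumn true  q k = - snoc 𝔽 q (1# + 1#) k

  shearScale : Bool → Carrier
  shearScale false = - 1#
  shearScale true  = 1#

  shearScale-leftInvertible : ∀ b → LeftInvertible 1# _*_ (shearScale b)
  shearScale-leftInvertible false = -1-leftInvertible
  shearScale-leftInvertible true  = 1# , *-identityˡ 1#

  shearColumn-last+shearScale≈-1 : ∀ {m} b (q : Fin m → Carrier) →
    shearColumn b q (fromℕ m) + shearScale b ≈ - 1#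
  shearColumn-last+shearScale≈-1 false q rewrite snoc-last q 0# = +-identityˡ (- 1#)
  shearColumn-last+shearScale≈-1 true  q rewrite snoc-last q (1# + 1#) = begin
    - (1# + 1#) + 1#      ≈⟨ +-comm (- (1# + 1#)) 1# ⟩
    1# - (1# + 1#)        ≈⟨ ⁻¹-anti-homo‿- (1# + 1#) 1# ⟨
    - ((1# + 1#) - 1#)    ≈⟨ -‿cong (xyx⁻¹≈y 1# 1#) ⟩
    - 1#                  ∎

  barRow≈shear-hypRow : ∀ {m n} (side : Fin n → Bool) (p : Fin n → Fin m → Carrier) {i j} →
    side i ≡ false × side j ≡ true → ∀ v k →
    barRow 𝔽 (λ v → snoc 𝔽 (p v) (if side v then 1# else 0#)) i j v k
      ≈ shear (shearColumn (side v) (p v)) (shearScale (side v)) (fromℕ m)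
              (hypRow 𝔽 (λ v → snoc 𝔽 (p v) 1#) i j v) k
  barRow≈shear-hypRow side p {i} {j} (side-i , side-j) v k with v ≟ i
  ... | yes ≡.refl rewrite side-i | side-j | snoc-last (p j) 1# =
    sym (+-cong (*-identityʳ _) (-1*x≈-x _))
  ... | no _ with v ≟ j
  ... | yes ≡.refl rewrite side-i | side-j | snoc-last (p i) 1# = begin
    snoc 𝔽 (p j) 1# k - snoc 𝔽 (p i) 0# k                    ≈⟨ snoc-differenceCong (p j) (p i) 1-0≈2-1 k ⟩
    snoc 𝔽 (p j) (1# + 1#) k - snoc 𝔽 (p i) 1# k             ≈⟨ +-cong -x*-1≈x (*-identityˡ _) ⟨
    - snoc 𝔽 (p j) (1# + 1#) k * - 1# + 1# * - snoc 𝔽 (p i) 1# k ∎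
    where
    -x*-1≈x : ∀ {x} → - x * - 1# ≈ x
    -x*-1≈x {x} = trans (*-comm (- x) (- 1#)) (trans (-1*x≈-x (- x)) (⁻¹-involutive x))
    1-0≈2-1 : 1# - 0# ≈ (1# + 1#) - 1#
    1-0≈2-1 = trans (trans (+-cong refl ε⁻¹≈ε) (+-identityʳ 1#)) (sym (xyx⁻¹≈y 1# 1#))
  ... | no _ = sym (linear-zero _ _)

theorem4p4 : {c ℓ : Level} (𝔽 : Field c ℓ) (m : ℕ) → 1 ≤ m →
    (n : ℕ) (side : Fin n → Bool) (p : Fin n → Fin m → Field.Carrier 𝔽) →
    (S : Fin n → Fin n → Bool) → BipartiteEdgeSet side S →
    RowsIndependent 𝔽 (barRow 𝔽 (λ v → snoc 𝔽 (p v) (if side v then Field.1# 𝔽 else Field.0# 𝔽))) S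
      ⇔ RowsIndependent 𝔽 (hypRow 𝔽 (λ v → snoc 𝔽 (p v) (Field.1# 𝔽))) S
theorem4p4 𝔽 m _ n side p S bipartite =
  rowsIndependent-shear 𝔽 S
    (λ v → shearColumn 𝔽 (side v) (p v)) (λ v → shearScale 𝔽 (side v)) (fromℕ m)
    (λ i j ij∈S → barRow≈shear-hypRow 𝔽 side p (bipartite i j ij∈S))
    (λ v → shearScale-leftInvertible 𝔽 (side v))
    (λ v → leftInvertible-resp 𝔽 (shearColumn-last+shearScale≈-1 𝔽 (side v) (p v)) (-1-leftInvertible 𝔽))
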